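{- Fix $\epsilon>0$. Let $\mathcal{J}$ be a finite set of jobs with positive integer processing times $p_j$ and nondecreasing cost functions $f_j:\{1,\dots,T\}\to\mathbb{Z}_{\ge0}$, where $T=\sum_jp_j$, $\mathcal{T}=\{1,\dots,T\}$ and $D(t)=T-t+1$. Let $\widehat{\mathcal{T}}=\{t_1<\dots<t_\tau\}$ and $f'_j$ be as defined in the context, and consider the integer programs (IP): minimize $\sum_j\sum_{t\in\mathcal{T}}f_j(t)x_{jt}$ subject to $\sum_j\sum_{s\in\mathcal{T}:s\ge t}p_jx_{js}\ge D(t)$ for all $t\in\mathcal{T}$, $\sum_{t\in\mathcal{T}}x_{jt}=1$ for all $j$, $x_{jt}\in\{0,1\}$; (IP$'$): minimize $\sum_j\sum_{t\in\widehat{\mathcal{T}}}f'_j(t)x'_{jt}$ subject to $\sum_j\sum_{s\in\widehat{\mathcal{T}}:s\ge t}p_jx'_{js}\ge D(t)$ for all $t\in\widehat{\mathcal{T}}$, $\sum_{t\in\widehat{\mathcal{T}}}x'_{jt}=1$ for all $j$, $x'_{jt}\in\{0,1\}$. If (IP) has a feasible solution with objective value $v$, then (IP$'$) has a feasible solution with objective value at most $(1+\epsilon)v$.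
   Context: For each job $j$ let $I^0_j=\{t\in\mathcal{T}: f_j(t)=0\}$ and, for $k\ge1$, $I^k_j=\{t\in\mathcal{T}:(1+\epsilon)^{k-1}\le f_j(t)<(1+\epsilon)^k\}$; let $\widehat{\mathcal{T}}_j$ be the set of minimum elements of the nonempty $I^k_j$, and $\widehat{\mathcal{T}}=\{1\}\cup\bigcup_j\widehat{\mathcal{T}}_j=\{t_1<\dots<t_\tau\}$ (so $t_1=1$). Set $t_{\tau+1}=T+1$. The modified costs are $f'_j(t_i)=f_j(t_{i+1}-1)$ for $i=1,\dots,\tau$, i.e. the cost of $j$ at the right endpoint of the interval $[t_i,t_{i+1}-1]$.
   Formalization: The parameter ε ranges over the positive rationals. -}

module Defs where

open import Data.Nat as ℕ using (ℕ; zero; suc; _+_; _*_; _∸_; _≤_; _<_)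
open import Data.Integer using (+_)
open import Data.Rational as ℚ using (ℚ; 1ℚ; _/_)
open import Data.Fin using (Fin)
open import Data.List using (List; map; upTo; tabulate)
open import Data.Nat.ListAction using (sum)
open import Data.Bool using (Bool; true; false; if_then_else_)
open import Data.Product using (Σ; ∃; _×_; _,_)
open import Data.Sum using (_⊎_)
open import Relation.Binary.PropositionalEquality using (_≡_)

toℚ : ℕ → ℚ
toℚ v = (+ v) / 1

pow : ℚ → ℕ → ℚ
pow q zero    = 1ℚ
pow q (suc k) = q ℚ.* pow q k

sumJ : {n : ℕ} → (Fin n → ℕ) → ℕ
sumJ {n} g = sum (tabulate {n = n} g)

-- Σ_{s = a}^{b} g s   (empty if b < a)
sumFromTo : ℕ → ℕ → (ℕ → ℕ) → ℕ
sumFromTo a b g = sum (map (λ i → g (a + i)) (upTo (suc b ∸ a)))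

horizon : {n : ℕ} → (Fin n → ℕ) → ℕ
horizon p = sumJ p

InT : ℕ → ℕ → Set
InT T t = 1 ≤ t × t ≤ T

D : ℕ → ℕ → ℕ
D T t = T ∸ t + 1

Nondecreasing : ℕ → (ℕ → ℕ) → Set
Nondecreasing T f = ∀ s t → InT T s → InT T t → s ≤ t → f s ≤ f t

-- (IP)
-- x j t ∈ {0,1}; only t ∈ 𝒯 are used.

objIP : {n : ℕ} → ℕ → (Fin n → ℕ → ℕ) → (Fin n → ℕ → ℕ) → ℕ
objIP T f x = sumJ (λ j → sumFromTo 1 T (λ t → f j t * x j t))

FeasibleIP : {n : ℕ} → (Fin n → ℕ) → (Fin n → ℕ → ℕ) → Set
FeasibleIP {n} p x =
  let T = horizon p in
  (∀ t → InT T t → D T t ≤ sumJ (λ j → sumFromTo t T (λ s → p j * x j s)))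
  × (∀ (j : Fin n) → sumFromTo 1 T (x j) ≡ 1)
  × (∀ (j : Fin n) t → InT T t → x j t ≤ 1)

InI : ℚ → ℕ → (ℕ → ℕ) → ℕ → ℕ → Set
InI ε T f zero    t = InT T t × f t ≡ 0
InI ε T f (suc k) t = InT T t
                     × (pow (1ℚ ℚ.+ ε) k ℚ.≤ toℚ (f t))
                     × (toℚ (f t) ℚ.< pow (1ℚ ℚ.+ ε) (suc k))

IsMinI : ℚ → ℕ → (ℕ → ℕ) → ℕ → ℕ → Set
IsMinI ε T f k t = InI ε T f k t × (∀ s → InI ε T f k s → t ≤ s)

InHat : {n : ℕ} → ℚ → ℕ → (Fin n → ℕ → ℕ) → ℕ → Set
InHat {n} ε T f t = t ≡ 1 ⊎ Σ (Fin n) (λ j → ∃ λ k → IsMinI ε T (f j) k t)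

-- hat : a Boolean decider for membership in 𝒯̂.
-- next hat T t = least s with t < s ≤ T and hat s, or T+1 if none
-- (i.e. t_{i+1} when t = t_i, with t_{τ+1} = T+1).
nextGo : (ℕ → Bool) → ℕ → ℕ → ℕ
nextGo hat zero    s = s
nextGo hat (suc k) s = if hat s then s else nextGo hat k (suc s)

next : (ℕ → Bool) → ℕ → ℕ → ℕ
next hat T t = nextGo hat (T ∸ t) (suc t)

f' : {n : ℕ} → (ℕ → Bool) → ℕ → (Fin n → ℕ → ℕ) → Fin n → ℕ → ℕ
f' hat T f j t = f j (next hat T t ∸ 1)

ind : (ℕ → Bool) → ℕ → ℕ
ind hat t = if hat t then 1 else 0

-- (IP'): variables x' j t for t ∈ 𝒯̂; sums over 𝒯̂ are sums over 𝒯
-- weighted by the indicator of 𝒯̂.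

objIP' : {n : ℕ} → (ℕ → Bool) → ℕ → (Fin n → ℕ → ℕ) → (Fin n → ℕ → ℕ) → ℕ
objIP' hat T f x' =
  sumJ (λ j → sumFromTo 1 T (λ t → ind hat t * (f' hat T f j t * x' j t)))

FeasibleIP' : {n : ℕ} → (ℕ → Bool) → (Fin n → ℕ) → (Fin n → ℕ → ℕ) → Set
FeasibleIP' {n} hat p x' =
  let T = horizon p in
  (∀ t → InT T t → hat t ≡ true →
     D T t ≤ sumJ (λ j → sumFromTo t T (λ s → ind hat s * (p j * x' j s))))
  × (∀ (j : Fin n) → sumFromTo 1 T (λ t → ind hat t * x' j t) ≡ 1)
  × (∀ (j : Fin n) t → InT T t → hat t ≡ true → x' j t ≤ 1)

-- Move every job j from its slot σ_j in x to the start t_i of the interval [t_i, t_{i+1} − 1] of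
-- 𝒯̂ that contains σ_j. A job counted in the covering constraint at some t ∈ 𝒯̂ with t ≤ σ_j is
-- still counted, because t ≤ t_i; so x' is feasible for (IP'). Its new cost is
-- f'_j(t_i) = f_j(t_{i+1} − 1). The least element m of the cost class of t_{i+1} − 1 lies in 𝒯̂
-- and not after t_{i+1} − 1, hence m ≤ t_i ≤ σ_j; costs within one class differ by less than a
-- factor 1 + ε, so f_j(t_{i+1} − 1) ≤ (1 + ε) f_j(m) ≤ (1 + ε) f_j(σ_j) by monotonicity.

module Submission where

open import Defs
open import Data.Fin as Fin using (Fin)
open import Data.Nat using (ℕ)
open import Data.Rational using (ℚ; Positive)
open import Data.Bool using (Bool; true; false; if_then_else_)
open import Data.Product using (∃-syntax; _×_; _,_; proj₁; proj₂)
open import Function.Bundles using (_⇔_)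
open import Relation.Binary.PropositionalEquality

module FiniteSums where

  open import Data.Nat
  open import Data.Nat.Properties
  open import Data.List using (applyUpTo)
  open import Data.List.Properties using (map-upTo; tabulate-cong)
  open import Data.Nat.ListAction using (sum)
  open import Function using (_∘_)
  open import Relation.Nullary using (contradiction)

  sum-applyUpTo-≡0 : ∀ k (g : ℕ → ℕ) → (∀ {i} → i < k → g i ≡ 0) →
                     sum (applyUpTo g k) ≡ 0
  sum-applyUpTo-≡0 zero    g _   = refl
  sum-applyUpTo-≡0 (suc k) g g≡0 =
    cong₂ _+_ (g≡0 z<s) (sum-applyUpTo-≡0 k (g ∘ suc) (g≡0 ∘ s<s))

  sum-applyUpTo-≡0⁻¹ : ∀ k (g : ℕ → ℕ) → sum (applyUpTo g k) ≡ 0 →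
                       ∀ {i} → i < k → g i ≡ 0
  sum-applyUpTo-≡0⁻¹ (suc k) g eq {zero}  _         = m+n≡0⇒m≡0 (g 0) eq
  sum-applyUpTo-≡0⁻¹ (suc k) g eq {suc i} (s<s i<k) =
    sum-applyUpTo-≡0⁻¹ k (g ∘ suc) (m+n≡0⇒n≡0 (g 0) eq) i<k

  sum-applyUpTo-single : ∀ k (g : ℕ → ℕ) {c} → c < k →
                         (∀ {i} → i < k → i ≢ c → g i ≡ 0) →
                         sum (applyUpTo g k) ≡ g c
  sum-applyUpTo-single (suc k) g {zero} _ g≡0 = begin
    g 0 + sum (applyUpTo (g ∘ suc) k)
      ≡⟨ cong (g 0 +_) (sum-applyUpTo-≡0 k (g ∘ suc) (λ i<k → g≡0 (s<s i<k) λ ())) ⟩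
    g 0 + 0
      ≡⟨ +-identityʳ (g 0) ⟩
    g 0 ∎
    where open ≡-Reasoning
  sum-applyUpTo-single (suc k) g {suc c} (s<s c<k) g≡0 =
    cong₂ _+_ (g≡0 z<s λ ())
      (sum-applyUpTo-single k (g ∘ suc) c<k (λ i<k i≢c → g≡0 (s<s i<k) (i≢c ∘ suc-injective)))

  sum-applyUpTo-≡1 : ∀ k (g : ℕ → ℕ) → (∀ {i} → i < k → g i ≤ 1) →
                     sum (applyUpTo g k) ≡ 1 →
                     ∃[ c ] c < k × g c ≡ 1 × (∀ {i} → i < k → i ≢ c → g i ≡ 0)
  sum-applyUpTo-≡1 (suc k) g g≤1 eq with g 0 in g0≡ | g≤1 {0} z<s
  ... | 0 | _ =
    let c , c<k , gc≡1 , g≡0 = sum-applyUpTo-≡1 k (g ∘ suc) (g≤1 ∘ s<s) eq in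
    suc c , s<s c<k , gc≡1 , λ
      { {zero}  _         _   → g0≡
      ; {suc i} (s<s i<k) i≢c → g≡0 i<k (i≢c ∘ cong suc)
      }
  ... | 1 | _ =
    0 , z<s , g0≡ , λ
      { {zero}  _         0≢0 → contradiction refl 0≢0
      ; {suc i} (s<s i<k) _   → sum-applyUpTo-≡0⁻¹ k (g ∘ suc) (suc-injective eq) i<k
      }

  sumFromTo-applyUpTo : ∀ a b (g : ℕ → ℕ) →
                        sumFromTo a b g ≡ sum (applyUpTo (λ i → g (a + i)) (suc b ∸ a))
  sumFromTo-applyUpTo a b g = cong sum (map-upTo (λ i → g (a + i)) (suc b ∸ a))

  ∸-offset-< : ∀ {a b s} → a ≤ s → s ≤ b → s ∸ a < suc b ∸ a
  ∸-offset-< a≤s s≤b = ∸-monoˡ-< (s≤s s≤b) a≤s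

  +-offset-≤ : ∀ a {b i} → i < suc b ∸ a → a + i ≤ b
  +-offset-≤ a {b} {i} i<b+1-a = s≤s⁻¹ (begin-strict
      a + i             <⟨ +-monoʳ-< a i<b+1-a ⟩
      a + (suc b ∸ a)   ≡⟨ m+[n∸m]≡n (<⇒≤ a<b+1) ⟩
      suc b             ∎)
    where
    open ≤-Reasoning
    a<b+1 : a < suc b
    a<b+1 = m∸n≢0⇒n<m (λ b+1-a≡0 → n≮0 (subst (i <_) b+1-a≡0 i<b+1-a))

  sumFromTo-≡0 : ∀ a b (g : ℕ → ℕ) → (∀ {s} → a ≤ s → s ≤ b → g s ≡ 0) →
                 sumFromTo a b g ≡ 0
  sumFromTo-≡0 a b g g≡0 = trans (sumFromTo-applyUpTo a b g)
    (sum-applyUpTo-≡0 _ _ (λ i< → g≡0 (m≤m+n a _) (+-offset-≤ a i<)))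

  sumFromTo-single : ∀ a b (g : ℕ → ℕ) {c} → a ≤ c → c ≤ b →
                     (∀ {s} → a ≤ s → s ≤ b → s ≢ c → g s ≡ 0) →
                     sumFromTo a b g ≡ g c
  sumFromTo-single a b g {c} a≤c c≤b g≡0 = begin
    sumFromTo a b g                                 ≡⟨ sumFromTo-applyUpTo a b g ⟩
    sum (applyUpTo (λ i → g (a + i)) (suc b ∸ a))
      ≡⟨ sum-applyUpTo-single _ _ (∸-offset-< a≤c c≤b) off-c ⟩
    g (a + (c ∸ a))                                 ≡⟨ cong g (m+[n∸m]≡n a≤c) ⟩
    g c                                             ∎
    where
    open ≡-Reasoning
    off-c : ∀ {i} → i < suc b ∸ a → i ≢ c ∸ a → g (a + i) ≡ 0
    off-c {i} i< i≢c-a = g≡0 (m≤m+n a i) (+-offset-≤ a i<)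
      (λ a+i≡c → i≢c-a (trans (sym (m+n∸m≡n a i)) (cong (_∸ a) a+i≡c)))

  sumFromTo-≡1 : ∀ a b (g : ℕ → ℕ) → (∀ {s} → a ≤ s → s ≤ b → g s ≤ 1) →
                 sumFromTo a b g ≡ 1 →
                 ∃[ c ] a ≤ c × c ≤ b × g c ≡ 1 × (∀ {s} → a ≤ s → s ≤ b → s ≢ c → g s ≡ 0)
  sumFromTo-≡1 a b g g≤1 eq =
    let i , i< , g≡1 , g≡0 = sum-applyUpTo-≡1 _ (λ i → g (a + i))
                               (λ i< → g≤1 (m≤m+n a _) (+-offset-≤ a i<))
                               (trans (sym (sumFromTo-applyUpTo a b g)) eq)
    in a + i , m≤m+n a i , +-offset-≤ a i< , g≡1 , λ {s} a≤s s≤b s≢a+i →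
         subst (λ z → g z ≡ 0) (m+[n∸m]≡n a≤s)
           (g≡0 (∸-offset-< a≤s s≤b)
             (λ s-a≡i → s≢a+i (trans (sym (m+[n∸m]≡n a≤s)) (cong (a +_) s-a≡i))))

  sumJ-cong : ∀ {n} {g h : Fin n → ℕ} → (∀ j → g j ≡ h j) → sumJ g ≡ sumJ h
  sumJ-cong g≗h = cong sum (tabulate-cong g≗h)

  sumJ-mono : ∀ {n} {g h : Fin n → ℕ} → (∀ j → g j ≤ h j) → sumJ g ≤ sumJ h
  sumJ-mono {zero}  _   = z≤n
  sumJ-mono {suc n} g≤h = +-mono-≤ (g≤h Fin.zero) (sumJ-mono (g≤h ∘ Fin.suc))

module KroneckerDelta where

  open import Data.Nat
  open import Data.Nat.Properties
  open import Relation.Nullary using (yes; no; contradiction)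

  δ : ℕ → ℕ → ℕ
  δ c s with s ≟ c
  ... | yes _ = 1
  ... | no  _ = 0

  δ-diag : ∀ c → δ c c ≡ 1
  δ-diag c with c ≟ c
  ... | yes _   = refl
  ... | no  c≢c = contradiction refl c≢c

  δ-off : ∀ {c s} → s ≢ c → δ c s ≡ 0
  δ-off {c} {s} s≢c with s ≟ c
  ... | yes s≡c = contradiction s≡c s≢c
  ... | no  _   = refl

  δ-≤1 : ∀ c s → δ c s ≤ 1
  δ-≤1 c s with s ≟ c
  ... | yes _ = ≤-refl
  ... | no  _ = z≤n

  *-δ-off : ∀ a {c s} → s ≢ c → a * δ c s ≡ 0
  *-δ-off a s≢c = trans (cong (a *_) (δ-off s≢c)) (*-zeroʳ a)

  *-*-δ-off : ∀ a b {c s} → s ≢ c → a * (b * δ c s) ≡ 0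
  *-*-δ-off a b s≢c = trans (cong (a *_) (*-δ-off b s≢c)) (*-zeroʳ a)

module LeastWitness where

  open import Data.Nat
  open import Data.Nat.Properties
  open import Relation.Nullary using (¬_; yes; no; contradiction)
  open import Relation.Unary using (Pred; Decidable)

  least-witness : ∀ {ℓ} {P : Pred ℕ ℓ} → Decidable P → ∀ {n} → P n →
                  ∃[ m ] P m × (∀ {i} → i < m → ¬ P i)
  least-witness {P = P} P? = search 0 (λ ())
    where
    search : ∀ k → (∀ {i} → i < k → ¬ P i) → ∀ {d} → P (k + d) →
             ∃[ m ] P m × (∀ {i} → i < m → ¬ P i)
    search k below {d} Pk+d with P? k
    ... | yes Pk = k , Pk , below
    search k below {zero}  Pk+d | no ¬Pk = contradiction (subst P (+-identityʳ k) Pk+d) ¬Pk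
    search k below {suc d} Pk+d | no ¬Pk = search (suc k) below′ (subst P (+-suc k d) Pk+d)
      where
      below′ : ∀ {i} → i < suc k → ¬ P i
      below′ {i} i<k+1 with i ≟ k
      ... | yes refl = ¬Pk
      ... | no i≢k   = below (≤∧≢⇒< (s≤s⁻¹ i<k+1) i≢k)

module NatToRational where

  open import Data.Nat as ℕ using (ℕ; zero; suc)
  open import Data.Integer as ℤ using (+_)
  import Data.Integer.Properties as ℤP
  open import Data.Rational as ℚ using (ℚ; mkℚ; 0ℚ; _+_; _*_; _≤_; _<_; *≤*; *<*)
  open import Data.Rational.Properties
  import Data.Nat.Coprimality as Coprime
  open import Function using (_∘_)

  toℚ≡mkℚ : ∀ v → toℚ v ≡ mkℚ (+ v) 0 (Coprime.sym (Coprime.1-coprimeTo v))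
  toℚ≡mkℚ v = ↥p/↧p≡p (mkℚ (+ v) 0 (Coprime.sym (Coprime.1-coprimeTo v)))

  toℚ-+ : ∀ a b → toℚ (a ℕ.+ b) ≡ toℚ a + toℚ b
  toℚ-+ a b rewrite toℚ≡mkℚ a | toℚ≡mkℚ b =
    /-cong {p₁ = + (a ℕ.+ b)} {q₁ = 1}
      (trans (ℤP.pos-+ a b) (sym (cong₂ ℤ._+_ (ℤP.*-identityʳ (+ a)) (ℤP.*-identityʳ (+ b))))) refl

  toℚ-mono-≤ : ∀ {a b} → a ℕ.≤ b → toℚ a ≤ toℚ b
  toℚ-mono-≤ {a} {b} a≤b rewrite toℚ≡mkℚ a | toℚ≡mkℚ b =
    *≤* (subst₂ ℤ._≤_ (sym (ℤP.*-identityʳ (+ a))) (sym (ℤP.*-identityʳ (+ b))) (ℤ.+≤+ a≤b))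

  toℚ-mono-< : ∀ {a b} → a ℕ.< b → toℚ a < toℚ b
  toℚ-mono-< {a} {b} a<b rewrite toℚ≡mkℚ a | toℚ≡mkℚ b =
    *<* (subst₂ ℤ._<_ (sym (ℤP.*-identityʳ (+ a))) (sym (ℤP.*-identityʳ (+ b))) (ℤ.+<+ a<b))

  0≤toℚ : ∀ v → 0ℚ ≤ toℚ v
  0≤toℚ v = toℚ-mono-≤ (ℕ.z≤n {v})

  sumJ-scaled-≤ : ∀ {n} (c : ℚ) {g h : Fin n → ℕ} → (∀ j → toℚ (g j) ≤ c * toℚ (h j)) →
                  toℚ (sumJ g) ≤ c * toℚ (sumJ h)
  sumJ-scaled-≤ {zero}  c _   = ≤-reflexive (sym (*-zeroʳ c))
  sumJ-scaled-≤ {suc n} c {g} {h} g≤ch = begin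
    toℚ (g Fin.zero ℕ.+ sumJ (g ∘ Fin.suc))             ≡⟨ toℚ-+ (g Fin.zero) _ ⟩
    toℚ (g Fin.zero) + toℚ (sumJ (g ∘ Fin.suc))
      ≤⟨ +-mono-≤ (g≤ch Fin.zero) (sumJ-scaled-≤ c (g≤ch ∘ Fin.suc)) ⟩
    c * toℚ (h Fin.zero) + c * toℚ (sumJ (h ∘ Fin.suc)) ≡⟨ *-distribˡ-+ c _ _ ⟨
    c * (toℚ (h Fin.zero) + toℚ (sumJ (h ∘ Fin.suc)))   ≡⟨ cong (c *_) (toℚ-+ (h Fin.zero) _) ⟨
    c * toℚ (h Fin.zero ℕ.+ sumJ (h ∘ Fin.suc))         ∎
    where open ≤-Reasoning

module PowerGrowth where

  open NatToRational
  open import Data.Nat as ℕ using (ℕ; zero; suc)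
  import Data.Nat.Properties as ℕP
  open import Data.Integer as ℤ using (+_; +[1+_])
  import Data.Integer.Properties as ℤP
  open import Data.Rational as ℚ using (ℚ; mkℚ; 1ℚ; 0ℚ; _+_; _*_; _≤_; _<_; Positive; toℚᵘ)
  open import Data.Rational.Properties
  import Data.Rational.Unnormalised as ℚᵘ
  import Data.Rational.Unnormalised.Properties as ℚᵘP
  open import Data.Rational.Solver using (module +-*-Solver)

  0≤p∧0≤q⇒0≤p*q : ∀ {p q} → 0ℚ ≤ p → 0ℚ ≤ q → 0ℚ ≤ p * q
  0≤p∧0≤q⇒0≤p*q {p} {q} 0≤p 0≤q =
    nonNegative⁻¹ (p * q) {{nonNeg*nonNeg⇒nonNeg p {{ℚ.nonNegative 0≤p}} q {{ℚ.nonNegative 0≤q}}}}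

  p≤p+q : ∀ p {q} → 0ℚ ≤ q → p ≤ p + q
  p≤p+q p {q} 0≤q = subst (_≤ p + q) (+-identityʳ p) (+-monoʳ-≤ p 0≤q)

  0≤p⇒0≤1+p : ∀ {p} → 0ℚ ≤ p → 0ℚ ≤ 1ℚ + p
  0≤p⇒0≤1+p 0≤p = ≤-trans (0≤toℚ 1) (p≤p+q 1ℚ 0≤p)

  positive⇒0≤ : ∀ {p} → Positive p → 0ℚ ≤ p
  positive⇒0≤ {p} p>0 = <⇒≤ (positive⁻¹ p {{p>0}})

  1+p*-monoʳ-≤ : ∀ {p q r} → 0ℚ ≤ p → q ≤ r → (1ℚ + p) * q ≤ (1ℚ + p) * r
  1+p*-monoʳ-≤ {p} 0≤p = *-monoˡ-≤-nonNeg (1ℚ + p) {{ℚ.nonNegative (0≤p⇒0≤1+p 0≤p)}}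

  bernoulli-step : ∀ e k → (1ℚ + e) * (1ℚ + k * e) ≡ (1ℚ + (1ℚ + k) * e) + (k * e) * e
  bernoulli-step = solve 2 (λ e k → (con 1ℚ :+ e) :* (con 1ℚ :+ k :* e)
                                   := (con 1ℚ :+ (con 1ℚ :+ k) :* e) :+ (k :* e) :* e) refl
    where open +-*-Solver

  bernoulli : ∀ {ε} → 0ℚ ≤ ε → ∀ k → 1ℚ + toℚ k * ε ≤ pow (1ℚ + ε) k
  bernoulli {ε} 0≤ε zero = ≤-reflexive (trans (cong (λ z → 1ℚ + z) (*-zeroˡ ε)) (+-identityʳ 1ℚ))
  bernoulli {ε} 0≤ε (suc k) = begin
    1ℚ + toℚ (suc k) * ε                    ≡⟨ cong (λ z → 1ℚ + z * ε) (toℚ-+ 1 k) ⟩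
    1ℚ + (1ℚ + toℚ k) * ε
      ≤⟨ p≤p+q _ (0≤p∧0≤q⇒0≤p*q (0≤p∧0≤q⇒0≤p*q (0≤toℚ k) 0≤ε) 0≤ε) ⟩
    1ℚ + (1ℚ + toℚ k) * ε + toℚ k * ε * ε  ≡⟨ bernoulli-step ε (toℚ k) ⟨
    (1ℚ + ε) * (1ℚ + toℚ k * ε)             ≤⟨ 1+p*-monoʳ-≤ 0≤ε (bernoulli 0≤ε k) ⟩
    (1ℚ + ε) * pow (1ℚ + ε) k               ∎
    where open ≤-Reasoning

  -- With ε = (e + 1) / (d + 1), the witness v (d + 1) gives v (d + 1) ε = v (e + 1) ≥ v.
  archimedean : ∀ ε → Positive ε → ∀ v → ∃[ N ] toℚ v ≤ toℚ N * ε
  archimedean ε@(mkℚ +[1+ e ] d _) _ v = N , toℚᵘ-cancel-≤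
      (ℚᵘP.≤-respʳ-≃ (ℚᵘP.≃-sym (toℚᵘ-homo-* (toℚ N) ε))
        (subst₂ (λ a b → toℚᵘ a ℚᵘ.≤ toℚᵘ b ℚᵘ.* toℚᵘ ε) (sym (toℚ≡mkℚ v)) (sym (toℚ≡mkℚ N)) v≤Nε))
    where
    N : ℕ
    N = v ℕ.* suc d
    v≤Nε : ℚᵘ.mkℚᵘ (+ v) 0 ℚᵘ.≤ ℚᵘ.mkℚᵘ (+ N) 0 ℚᵘ.* ℚᵘ.mkℚᵘ +[1+ e ] d
    v≤Nε = ℚᵘ.*≤* (subst (λ z → + v ℤ.* +[1+ z ] ℤ.≤ (+ N ℤ.* +[1+ e ]) ℤ.* + 1)
      (sym (ℕP.+-identityʳ d)) cross)
      where
      cross : + v ℤ.* +[1+ d ] ℤ.≤ (+ N ℤ.* +[1+ e ]) ℤ.* + 1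
      cross rewrite ℤP.*-identityʳ (+ N ℤ.* +[1+ e ]) | sym (ℤP.pos-* v (suc d))
                  | sym (ℤP.pos-* N (suc e)) = ℤ.+≤+ (ℕP.m≤m*n N (suc e))

  pow-unbounded : ∀ ε → Positive ε → ∀ v → ∃[ K ] toℚ v < pow (1ℚ + ε) K
  pow-unbounded ε ε>0 v = let N , v≤Nε = archimedean ε ε>0 v in N , (begin-strict
    toℚ v            <⟨ toℚ-mono-< (ℕP.n<1+n v) ⟩
    toℚ (suc v)      ≡⟨ toℚ-+ 1 v ⟩
    1ℚ + toℚ v       ≤⟨ +-monoʳ-≤ 1ℚ v≤Nε ⟩
    1ℚ + toℚ N * ε   ≤⟨ bernoulli (positive⇒0≤ ε>0) N ⟩
    pow (1ℚ + ε) N   ∎)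
    where open ≤-Reasoning

module CostClasses (ε : ℚ) (T : ℕ) (g : ℕ → ℕ) where

  open NatToRational
  open PowerGrowth
  open LeastWitness
  open import Data.Nat as ℕ using (ℕ; zero; suc)
  import Data.Nat.Properties as ℕP
  open import Data.Rational as ℚ using (ℚ; 1ℚ; 0ℚ; _+_; _*_; _≤_; _<_; Positive)
  open import Data.Rational.Properties
  open import Relation.Nullary using (contradiction)
  open import Relation.Nullary.Decidable using (_×-dec_)
  open import Relation.Unary using (Decidable)

  InT? : Decidable (InT T)
  InT? t = (1 ℕ.≤? t) ×-dec (t ℕ.≤? T)

  InI? : ∀ k → Decidable (InI ε T g k)
  InI? zero    t = InT? t ×-dec (g t ℕ.≟ 0)
  InI? (suc k) t =
    InT? t ×-dec (pow (1ℚ + ε) k ≤? toℚ (g t)) ×-dec (toℚ (g t) <? pow (1ℚ + ε) (suc k))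

  InI⇒InT : ∀ k {t} → InI ε T g k t → InT T t
  InI⇒InT zero    (t∈T , _) = t∈T
  InI⇒InT (suc k) (t∈T , _) = t∈T

  class-of : Positive ε → ∀ {u} → InT T u → ∃[ k ] InI ε T g k u
  class-of ε>0 {u} u∈T
    with K , gu<q^K ← pow-unbounded ε ε>0 (g u)
    with least-witness (λ k → toℚ (g u) <? pow (1ℚ + ε) k) {K} gu<q^K
  ... | suc k , gu<q^k+1 , below = suc k , u∈T , ≮⇒≥ (below (ℕP.n<1+n k)) , gu<q^k+1
  ... | zero  , gu<1     , _ with g u in gu≡
  ...   | zero  = zero , u∈T , gu≡
  ...   | suc w = contradiction (<-≤-trans gu<1 (toℚ-mono-≤ (ℕ.s≤s (ℕ.z≤n {w})))) (<-irrefl refl)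

  class-min : ∀ {k u} → InI ε T g k u → ∃[ m ] IsMinI ε T g k m
  class-min {k} u∈I =
    let m , m∈I , below = least-witness (InI? k) u∈I
    in m , m∈I , λ s s∈I → ℕP.≮⇒≥ (λ s<m → below s<m s∈I)

  class-ratio : 0ℚ ≤ ε → Nondecreasing T g → ∀ {k m u s} → InI ε T g k m → InI ε T g k u →
                m ℕ.≤ s → InT T s → toℚ (g u) ≤ (1ℚ + ε) * toℚ (g s)
  class-ratio 0≤ε g-mono {zero} {s = s} _ (_ , gu≡0) _ _ rewrite gu≡0 =
    0≤p∧0≤q⇒0≤p*q (0≤p⇒0≤1+p 0≤ε) (0≤toℚ (g s))
  class-ratio 0≤ε g-mono {suc k} {m} {u} {s} (m∈T , q^k≤gm , _) (_ , _ , gu<q^k+1) m≤s s∈T =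
    <⇒≤ (begin-strict
      toℚ (g u)                       <⟨ gu<q^k+1 ⟩
      (1ℚ + ε) * pow (1ℚ + ε) k       ≤⟨ 1+p*-monoʳ-≤ 0≤ε (≤-trans q^k≤gm (toℚ-mono-≤ gm≤gs)) ⟩
      (1ℚ + ε) * toℚ (g s)            ∎)
    where
    open ≤-Reasoning
    gm≤gs : g m ℕ.≤ g s
    gm≤gs = g-mono m s m∈T s∈T m≤s

module Intervals (hat : ℕ → Bool) where

  open import Data.Nat
  open import Data.Nat.Properties
  open import Data.Sum using (_⊎_; inj₁; inj₂)
  open import Relation.Nullary using (yes; no; contradiction)

  nextGo-≥ : ∀ k a → a ≤ nextGo hat k a
  nextGo-≥ zero    a = ≤-refl
  nextGo-≥ (suc k) a with hat a
  ... | true  = ≤-refl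
  ... | false = ≤-trans (n≤1+n a) (nextGo-≥ k (suc a))

  nextGo-≤ : ∀ k a → nextGo hat k a ≤ a + k
  nextGo-≤ zero    a = ≤-reflexive (sym (+-identityʳ a))
  nextGo-≤ (suc k) a with hat a
  ... | true  = m≤m+n a (suc k)
  ... | false = subst (nextGo hat k (suc a) ≤_) (sym (+-suc a k)) (nextGo-≤ k (suc a))

  nextGo-unmarked : ∀ k a {s} → a ≤ s → s < nextGo hat k a → hat s ≡ false
  nextGo-unmarked zero    a a≤s s<a = contradiction a≤s (<⇒≱ s<a)
  nextGo-unmarked (suc k) a {s} a≤s s<next with hat a in hat-a
  ... | true  = contradiction a≤s (<⇒≱ s<next)
  ... | false with a ≟ s
  ...   | yes refl = hat-a
  ...   | no  a≢s  = nextGo-unmarked k (suc a) (≤∧≢⇒< a≤s a≢s) s<next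

  nextGo-marked⊎last : ∀ k a → hat (nextGo hat k a) ≡ true ⊎ nextGo hat k a ≡ a + k
  nextGo-marked⊎last zero    a = inj₂ (sym (+-identityʳ a))
  nextGo-marked⊎last (suc k) a with hat a in hat-a
  ... | true  = inj₁ hat-a
  ... | false with nextGo-marked⊎last k (suc a)
  ...   | inj₁ marked = inj₁ marked
  ...   | inj₂ last   = inj₂ (trans last (sym (+-suc a k)))

  next-> : ∀ T t → t < next hat T t
  next-> T t = nextGo-≥ (T ∸ t) (suc t)

  next-≤ : ∀ {T t} → t ≤ T → next hat T t ≤ suc T
  next-≤ {T} {t} t≤T = subst (next hat T t ≤_) (cong suc (m+[n∸m]≡n t≤T)) (nextGo-≤ (T ∸ t) (suc t))

  next-marked⊎end : ∀ {T t} → t ≤ T → hat (next hat T t) ≡ true ⊎ next hat T t ≡ suc T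
  next-marked⊎end {T} {t} t≤T with nextGo-marked⊎last (T ∸ t) (suc t)
  ... | inj₁ marked = inj₁ marked
  ... | inj₂ last   = inj₂ (trans last (cong suc (m+[n∸m]≡n t≤T)))

  marked-<-next⇒≤ : ∀ T t {s} → hat s ≡ true → s < next hat T t → s ≤ t
  marked-<-next⇒≤ T t {s} hat-s s<next with s ≤? t
  ... | yes s≤t = s≤t
  ... | no  s≰t with () ← trans (sym hat-s) (nextGo-unmarked (T ∸ t) (suc t) (≰⇒> s≰t) s<next)

  intervalStart : ℕ → ℕ
  intervalStart zero    = zero
  intervalStart (suc s) = if hat (suc s) then suc s else intervalStart s

  intervalEnd : ℕ → ℕ → ℕ
  intervalEnd T s = pred (next hat T (intervalStart s))

  intervalStart-≤ : ∀ s → intervalStart s ≤ s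
  intervalStart-≤ zero    = z≤n
  intervalStart-≤ (suc s) with hat (suc s)
  ... | true  = ≤-refl
  ... | false = m≤n⇒m≤1+n (intervalStart-≤ s)

  intervalStart-maximal : ∀ {s t} → t ≤ s → hat t ≡ true → t ≤ intervalStart s
  intervalStart-maximal {zero}  z≤n _ = z≤n
  intervalStart-maximal {suc s} {t} t≤s+1 hat-t with hat (suc s) in hat-s+1
  ... | true  = t≤s+1
  ... | false with t ≟ suc s
  ...   | yes refl with () ← trans (sym hat-t) hat-s+1
  ...   | no  t≢s+1 = intervalStart-maximal (s≤s⁻¹ (≤∧≢⇒< t≤s+1 t≢s+1)) hat-t

  intervalStart-marked⊎zero : ∀ s → hat (intervalStart s) ≡ true ⊎ intervalStart s ≡ 0
  intervalStart-marked⊎zero zero    = inj₂ refl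
  intervalStart-marked⊎zero (suc s) with hat (suc s) in hat-s+1
  ... | true  = inj₁ hat-s+1
  ... | false = intervalStart-marked⊎zero s

  intervalStart-marked : hat 1 ≡ true → ∀ {s} → 1 ≤ s → hat (intervalStart s) ≡ true
  intervalStart-marked hat-1 {s} 1≤s with intervalStart-marked⊎zero s
  ... | inj₁ marked = marked
  ... | inj₂ start≡0 = contradiction (subst (1 ≤_) start≡0 (intervalStart-maximal 1≤s hat-1)) λ ()

  <-next-intervalStart : ∀ {T s} → s ≤ T → s < next hat T (intervalStart s)
  <-next-intervalStart {T} {s} s≤T with next-marked⊎end (≤-trans (intervalStart-≤ s) s≤T)
  ... | inj₂ next≡T+1 = subst (s <_) (sym next≡T+1) (s≤s s≤T)
  ... | inj₁ marked   = ≰⇒> λ next≤s →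
    <⇒≱ (next-> T (intervalStart s)) (intervalStart-maximal next≤s marked)

  ≤-intervalEnd : ∀ {T s} → s ≤ T → s ≤ intervalEnd T s
  ≤-intervalEnd s≤T = <⇒≤pred (<-next-intervalStart s≤T)

  intervalEnd-≤ : ∀ {T s} → s ≤ T → intervalEnd T s ≤ T
  intervalEnd-≤ {s = s} s≤T = pred-mono-≤ (next-≤ (≤-trans (intervalStart-≤ s) s≤T))

  marked-≤-intervalEnd⇒≤-intervalStart : ∀ {T s m} → hat m ≡ true → m ≤ intervalEnd T s →
                                          m ≤ intervalStart s
  marked-≤-intervalEnd⇒≤-intervalStart {T} {s} hat-m m≤end =
    marked-<-next⇒≤ T (intervalStart s) hat-m
      (m≤pred[n]⇒suc[m]≤n {{>-nonZero (≤-<-trans z≤n (next-> T (intervalStart s)))}} m≤end)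

module Rounding
  (ε : ℚ) (ε>0 : Positive ε) {n : ℕ} (p : Fin n → ℕ) (f : Fin n → ℕ → ℕ)
  (f-mono : ∀ j → Nondecreasing (horizon p) (f j))
  (hat : ℕ → Bool)
  (hat⇔ : ∀ t → InT (horizon p) t → (hat t ≡ true ⇔ InHat ε (horizon p) f t))
  (x : Fin n → ℕ → ℕ) (x-feasible : FeasibleIP p x) where

  open FiniteSums
  open NatToRational
  open PowerGrowth using (positive⇒0≤)
  open KroneckerDelta
  open Intervals hat
  open import Data.Nat
  open import Data.Nat.Properties
  import Data.Rational as ℚ
  open import Data.Sum using (inj₁; inj₂)
  open import Function.Bundles using (Equivalence)
  open import Relation.Nullary using (yes; no)

  T : ℕ
  T = horizon p

  record Slot (y : ℕ → ℕ) : Set where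
    field
      time     : ℕ
      1≤time   : 1 ≤ time
      time≤T   : time ≤ T
      at-time  : y time ≡ 1
      off-time : ∀ {s} → 1 ≤ s → s ≤ T → s ≢ time → y s ≡ 0

  slot : ∀ j → Slot (x j)
  slot j =
    let x-sum≡1 = proj₁ (proj₂ x-feasible) j
        x-≤1 = λ {s} 1≤s s≤T → proj₂ (proj₂ x-feasible) j s (1≤s , s≤T)
        σ , 1≤σ , σ≤T , at , off = sumFromTo-≡1 1 T (x j) x-≤1 x-sum≡1
    in record { time = σ ; 1≤time = 1≤σ ; time≤T = σ≤T ; at-time = at ; off-time = off }

  module Job (j : Fin n) where
    open Slot (slot j) public

    start : ℕ
    start = intervalStart time

    end : ℕ
    end = intervalEnd T time

    hat-1 : hat 1 ≡ true
    hat-1 = Equivalence.from (hat⇔ 1 (≤-refl , ≤-trans 1≤time time≤T)) (inj₁ refl)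

    start-marked : hat start ≡ true
    start-marked = intervalStart-marked hat-1 1≤time

    1≤start : 1 ≤ start
    1≤start = intervalStart-maximal 1≤time hat-1

    start≤T : start ≤ T
    start≤T = ≤-trans (intervalStart-≤ time) time≤T

    ind-start : ind hat start ≡ 1
    ind-start = cong (λ b → if b then 1 else 0) start-marked

    weighted-x-sum : ∀ (w : ℕ → ℕ) {t} → 1 ≤ t → t ≤ time →
                     sumFromTo t T (λ s → w s * x j s) ≡ w time
    weighted-x-sum w {t} 1≤t t≤time = begin
      sumFromTo t T (λ s → w s * x j s)  ≡⟨ sumFromTo-single t T _ t≤time time≤T w*x≡0 ⟩
      w time * x j time                  ≡⟨ cong (w time *_) at-time ⟩
      w time * 1                         ≡⟨ *-identityʳ (w time) ⟩
      w time                             ∎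
      where
      open ≡-Reasoning
      w*x≡0 : ∀ {s} → t ≤ s → s ≤ T → s ≢ time → w s * x j s ≡ 0
      w*x≡0 {s} t≤s s≤T s≢time =
        trans (cong (w s *_) (off-time (≤-trans 1≤t t≤s) s≤T s≢time)) (*-zeroʳ (w s))

    weighted-x-sum-late : ∀ (w : ℕ → ℕ) {t} → 1 ≤ t → time < t →
                          sumFromTo t T (λ s → w s * x j s) ≡ 0
    weighted-x-sum-late w {t} 1≤t time<t = sumFromTo-≡0 t T (λ s → w s * x j s) λ {s} t≤s s≤T →
      trans (cong (w s *_) (off-time (≤-trans 1≤t t≤s) s≤T λ { refl → <⇒≱ time<t t≤s }))
            (*-zeroʳ (w s))

    weighted-δ-start-sum : ∀ (w : ℕ → ℕ) {t} → t ≤ start →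
                           sumFromTo t T (λ s → ind hat s * (w s * δ start s)) ≡ w start
    weighted-δ-start-sum w {t} t≤start = begin
      sumFromTo t T (λ s → ind hat s * (w s * δ start s))
        ≡⟨ sumFromTo-single t T _ t≤start start≤T (λ {s} _ _ → *-*-δ-off (ind hat s) (w s)) ⟩
      ind hat start * (w start * δ start start)
        ≡⟨ cong₂ (λ a b → a * (w start * b)) ind-start (δ-diag start) ⟩
      1 * (w start * 1)
        ≡⟨ *-identityˡ (w start * 1) ⟩
      w start * 1
        ≡⟨ *-identityʳ (w start) ⟩
      w start ∎
      where open ≡-Reasoning

    load-≤ : ∀ {t} → InT T t → hat t ≡ true →
             sumFromTo t T (λ s → p j * x j s) ≤ sumFromTo t T (λ s → ind hat s * (p j * δ start s))
    load-≤ {t} (1≤t , t≤T) hat-t with t ≤? time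
    ... | yes t≤time = ≤-reflexive (trans (weighted-x-sum (λ _ → p j) 1≤t t≤time)
                         (sym (weighted-δ-start-sum (λ _ → p j) (intervalStart-maximal t≤time hat-t))))
    ... | no  t≰time = ≤-trans (≤-reflexive (weighted-x-sum-late (λ _ → p j) 1≤t (≰⇒> t≰time))) z≤n

    cost-ratio : toℚ (f j end) ℚ.≤ (ℚ.1ℚ ℚ.+ ε) ℚ.* toℚ (f j time)
    cost-ratio =
      let k , end∈I = class-of ε>0 (≤-trans 1≤time (≤-intervalEnd time≤T) , intervalEnd-≤ time≤T)
          m , m∈I , m-least = class-min end∈I
          m-marked = Equivalence.from (hat⇔ m (InI⇒InT k m∈I)) (inj₂ (j , k , m∈I , m-least))
          m≤time = ≤-trans (marked-≤-intervalEnd⇒≤-intervalStart m-marked (m-least end end∈I))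
                           (intervalStart-≤ time)
      in class-ratio (positive⇒0≤ ε>0) (f-mono j) m∈I end∈I m≤time (1≤time , time≤T)
      where open CostClasses ε T (f j)

  x' : Fin n → ℕ → ℕ
  x' j = δ (Job.start j)

  x'-feasible : FeasibleIP' hat p x'
  x'-feasible = covers , δ-start-sum , λ j t _ _ → δ-≤1 (Job.start j) t
    where
    covers : ∀ t → InT T t → hat t ≡ true →
             D T t ≤ sumJ (λ j → sumFromTo t T (λ s → ind hat s * (p j * x' j s)))
    covers t t∈T hat-t = ≤-trans (proj₁ x-feasible t t∈T) (sumJ-mono λ j → Job.load-≤ j t∈T hat-t)
    δ-start-sum : ∀ j → sumFromTo 1 T (λ t → ind hat t * x' j t) ≡ 1
    δ-start-sum j =
      trans (sumFromTo-single 1 T _ (Job.1≤start j) (Job.start≤T j) λ {s} _ _ → *-δ-off (ind hat s))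
            (cong₂ _*_ (Job.ind-start j) (δ-diag (Job.start j)))

  objective-≤ : toℚ (objIP' hat T f x') ℚ.≤ (ℚ.1ℚ ℚ.+ ε) ℚ.* toℚ (objIP T f x)
  objective-≤ = subst₂ (λ a b → toℚ a ℚ.≤ (ℚ.1ℚ ℚ.+ ε) ℚ.* toℚ b)
    (sumJ-cong λ j → sym (Job.weighted-δ-start-sum j (f' hat T f j) (Job.1≤start j)))
    (sumJ-cong λ j → sym (Job.weighted-x-sum j (f j) ≤-refl (Job.1≤time j)))
    (sumJ-scaled-≤ (ℚ.1ℚ ℚ.+ ε) Job.cost-ratio)

open import Data.Nat using (_<_)
open import Data.Rational using (_≤_; _+_; _*_; 1ℚ)
open import Data.Product using (Σ)

lemma9 : (ε : ℚ) → Positive ε →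
         (n : ℕ) (p : Fin n → ℕ) → (∀ j → 0 < p j) →
         (f : Fin n → ℕ → ℕ) → (∀ j → Nondecreasing (horizon p) (f j)) →
         (hat : ℕ → Bool) →
         (∀ t → InT (horizon p) t → (hat t ≡ true ⇔ InHat ε (horizon p) f t)) →
         (x : Fin n → ℕ → ℕ) → FeasibleIP p x →
         Σ (Fin n → ℕ → ℕ) (λ x' → FeasibleIP' hat p x'
           × toℚ (objIP' hat (horizon p) f x') ≤ (1ℚ + ε) * toℚ (objIP (horizon p) f x))
lemma9 ε ε>0 n p _ f f-mono hat hat⇔ x x-feasible = x' , x'-feasible , objective-≤
  where open Rounding ε ε>0 p f f-mono hat hat⇔ x x-feasible
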